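{- Let $p$ be an odd prime, $G\in\mathcal{F}_n^p$ and $Q\in\mathcal{Q}(G)$. If $\ell(Q)=p$, then $\mathrm{rank}_p(pQ)=1$.
   Context: Graphs are finite, simple, undirected. For a graph $G$ on $n$ vertices with adjacency matrix $A$, $W(G)=[e,Ae,\ldots,A^{n-1}e]$ with $e$ the all-one vector. $\mathcal{F}_n$ is the family of graphs $G$ on $n$ vertices whose walk matrix has Smith normal form $\mathrm{diag}[1,\ldots,1,2,\ldots,2,2p^2b]$ ($\lceil n/2\rceil$ ones, followed by $\lfloor n/2\rfloor$ entries $2,\ldots,2,2p^2b$), where $b$ is odd and square-free, $p$ is an odd prime and $p\nmid b$; $\mathcal{F}_n^p=\{G\in\mathcal{F}_n: p^2\mid\det W(G)\}$. An orthogonal matrix $Q$ is regular if $Qe=e$. The level $\ell(Q)$ of a rational matrix $Q$ is the smallest positive integer $k$ with $kQ$ integral. $\mathcal{Q}(G)$ is the set of regular rational orthogonal matrices $Q$ such that $Q^{\mathrm T}A(G)Q$ is a symmetric $(0,1)$-matrix with zero diagonal. For an integral matrix $M$, $\mathrm{rank}_p M$ is its rank over $\mathbb{F}_p=\mathbb{Z}/p\mathbb{Z}$. -}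

module Defs where

open import Data.Nat as ℕ using (ℕ; zero; suc; _<_; _≤_; _∸_; ⌊_/2⌋; ⌈_/2⌉)
open import Data.Nat.Primality using (Prime)
open import Data.Nat.Divisibility renaming (_∣_ to _∣ℕ_) using ()
open import Data.Integer as ℤ using (ℤ; +_; -[1+_])
open import Data.Integer.Divisibility as ℤd using ()
open import Data.Rational as ℚ using (ℚ; 0ℚ; 1ℚ)
open import Data.Fin using (Fin; zero; suc; toℕ; punchIn)
open import Data.Product using (Σ; ∃; _×_; _,_)
open import Data.Sum using (_⊎_)
open import Relation.Binary.PropositionalEquality using (_≡_)
open import Relation.Nullary using (¬_; yes; no)

Mat : Set → ℕ → Set
Mat A n = Fin n → Fin n → A

sumℤ : ∀ {n} → (Fin n → ℤ) → ℤ
sumℤ {zero}  f = + 0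
sumℤ {suc n} f = f zero ℤ.+ sumℤ (λ i → f (suc i))

sumℚ : ∀ {n} → (Fin n → ℚ) → ℚ
sumℚ {zero}  f = 0ℚ
sumℚ {suc n} f = f zero ℚ.+ sumℚ (λ i → f (suc i))

_*ℤ_ : ∀ {n} → Mat ℤ n → Mat ℤ n → Mat ℤ n
(M *ℤ N) i j = sumℤ (λ k → M i k ℤ.* N k j)

_*ℚ_ : ∀ {n} → Mat ℚ n → Mat ℚ n → Mat ℚ n
(M *ℚ N) i j = sumℚ (λ k → M i k ℚ.* N k j)

transpose : ∀ {A : Set} {n} → Mat A n → Mat A n
transpose M i j = M j i

δ : ∀ {A : Set} {n} → A → A → Mat A n
δ {n = suc n} one zer zero    zero    = one
δ {n = suc n} one zer zero    (suc j) = zer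
δ {n = suc n} one zer (suc i) zero    = zer
δ {n = suc n} one zer (suc i) (suc j) = δ one zer i j

Iℤ : ∀ {n} → Mat ℤ n
Iℤ = δ (+ 1) (+ 0)

Iℚ : ∀ {n} → Mat ℚ n
Iℚ = δ 1ℚ 0ℚ

ℤtoℚ : ℤ → ℚ
ℤtoℚ z = z ℚ./ 1

minor : ∀ {A : Set} {n} → Fin (suc n) → Mat A (suc n) → Mat A n
minor j M r c = M (suc r) (punchIn j c)

sign : ℕ → ℤ
sign zero          = + 1
sign (suc zero)    = ℤ.- (+ 1)
sign (suc (suc k)) = sign k

det : ∀ {n} → Mat ℤ n → ℤ
det {zero}  M = + 1
det {suc n} M = sumℤ (λ j → sign (toℕ j) ℤ.* (M zero j ℤ.* det (minor j M)))

record Graph (n : ℕ) : Set where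
  field
    A     : Mat ℤ n
    zero-one : ∀ i j → A i j ≡ + 0 ⊎ A i j ≡ + 1
    symm  : ∀ i j → A i j ≡ A j i
    irrefl : ∀ i → A i i ≡ + 0

walkVec : ∀ {n} → Mat ℤ n → ℕ → Fin n → ℤ
walkVec A zero    i = + 1
walkVec A (suc k) i = sumℤ (λ j → A i j ℤ.* walkVec A k j)

W : ∀ {n} → Graph n → Mat ℤ n
W G i j = walkVec (Graph.A G) (toℕ j) i

Unimodular : ∀ {n} → Mat ℤ n → Set
Unimodular {n} U = Σ (Mat ℤ n) λ U' → (U *ℤ U' ≡ Iℤ) × (U' *ℤ U ≡ Iℤ)

diagMat : ∀ {n} → (Fin n → ℤ) → Mat ℤ n
diagMat d i j = δ (d i) (+ 0) i j

-- "the Smith normal form of M is diag[d]"  (d is a divisibility chain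
-- of nonnegative integers in all uses below)
HasSNF : ∀ {n} → Mat ℤ n → (Fin n → ℤ) → Set
HasSNF {n} M d = Σ (Mat ℤ n) λ U → Σ (Mat ℤ n) λ V →
  Unimodular U × Unimodular V × ((U *ℤ M) *ℤ V ≡ diagMat d)

-- diag[1,...,1 (⌈n/2⌉ times), 2,...,2, 2p²b (⌊n/2⌋ entries)]
snfShape : (n p b : ℕ) → Fin n → ℤ
snfShape n p b i with toℕ i ℕ.<? ⌈ n /2⌉
... | yes _ = + 1
... | no _ with toℕ i ℕ.≟ (n ∸ 1)
...   | yes _ = + (2 ℕ.* (p ℕ.* p) ℕ.* b)
...   | no _  = + 2

Odd : ℕ → Set
Odd m = ¬ (2 ∣ℕ m)

SquareFree : ℕ → Set
SquareFree m = ∀ d → (d ℕ.* d) ∣ℕ m → d ≡ 1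

InF : ∀ {n} → Graph n → Set
InF {n} G = Σ ℕ λ p → Σ ℕ λ b →
  Odd b × SquareFree b × Prime p × Odd p × ¬ (p ∣ℕ b) ×
  HasSNF (W G) (snfShape n p b)

InFp : ∀ {n} → ℕ → Graph n → Set
InFp p G = InF G × (+ (p ℕ.* p) ℤd.∣ det (W G))

ones : ∀ {n} → Fin n → ℚ
ones i = 1ℚ

Orthogonal : ∀ {n} → Mat ℚ n → Set
Orthogonal Q = transpose Q *ℚ Q ≡ Iℚ

Regular : ∀ {n} → Mat ℚ n → Set
Regular Q = ∀ i → sumℚ (λ j → Q i j) ≡ 1ℚ

IsAdjMatrixℚ : ∀ {n} → Mat ℚ n → Set
IsAdjMatrixℚ B = (∀ i j → B i j ≡ 0ℚ ⊎ B i j ≡ 1ℚ)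
               × (∀ i j → B i j ≡ B j i)
               × (∀ i → B i i ≡ 0ℚ)

InQ : ∀ {n} → Graph n → Mat ℚ n → Set
InQ G Q = Orthogonal Q × Regular Q ×
  IsAdjMatrixℚ ((transpose Q *ℚ (λ i j → ℤtoℚ (Graph.A G i j))) *ℚ Q)

IsIntegral : ℚ → Set
IsIntegral q = ∃ λ (z : ℤ) → q ≡ ℤtoℚ z

IntegralMat : ∀ {n} → Mat ℚ n → Set
IntegralMat Q = ∀ i j → IsIntegral (Q i j)

scale : ∀ {n} → ℕ → Mat ℚ n → Mat ℚ n
scale k Q i j = ℤtoℚ (+ k) ℚ.* Q i j

Level : ∀ {n} → Mat ℚ n → ℕ → Set
Level Q k = (0 < k) × IntegralMat (scale k Q)
          × (∀ m → 0 < m → m < k → ¬ IntegralMat (scale m Q))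

ColsIndepMod : ∀ {n r} → ℕ → Mat ℤ n → (Fin r → Fin n) → Set
ColsIndepMod {n} {r} p M f =
  ∀ (c : Fin r → ℤ) →
    (∀ i → + p ℤd.∣ sumℤ (λ j → c j ℤ.* M i (f j))) →
    ∀ j → + p ℤd.∣ c j

RankMod : ∀ {n} → ℕ → Mat ℤ n → ℕ → Set
RankMod {n} p M r =
  (Σ (Fin r → Fin n) λ f → ColsIndepMod p M f)
  × (∀ (g : Fin (suc r) → Fin n) → ¬ ColsIndepMod p M g)

-- Since Q is regular and orthogonal and B = QᵀAQ is a (0,1)-matrix, Qᵀ Aᵏ e = Bᵏ Qᵀ e = Bᵏ e
-- is integral for every k: every column of pQ lies in the left kernel of W(G) modulo p. In the
-- Smith normal form U W V = diag(1,…,1,2,…,2,2p²b) every invariant factor but the last is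
-- invertible modulo the odd prime p, so this kernel is spanned by the last row of U. Hence the
-- columns of pQ are proportional modulo p, and pQ ≢ 0 (mod p) because ℓ(Q) = p > 1 means that Q
-- is not integral. The identity QQᵀ = 1 used above follows from QᵀQ = 1 by a trace argument.

module Submission where

open import Defs
open import Algebra.Bundles using (CommutativeRing)
open import Level using (0ℓ)
open import Data.Nat as ℕ using (ℕ; zero; suc)
open import Data.Nat.Primality using (Prime; euclidsLemma; prime⇒nonTrivial; prime⇒nonZero)
open import Data.Fin using (Fin; zero; suc; toℕ)
open import Data.Vec.Functional using (tail)
open import Data.Integer as ℤ using (ℤ; +_; -[1+_])
open import Data.Rational as ℚ using (ℚ; mkℚ; 0ℚ; 1ℚ)
open import Relation.Binary.PropositionalEquality using (_≡_)

module MatrixAlgebra {ℓ} (R : CommutativeRing 0ℓ ℓ) where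

  open CommutativeRing R hiding (zero)
  open import Algebra.Properties.Ring ring using (-0#≈0#; -‿+-comm; x[y-z]≈xy-xz; [y-z]x≈yx-zx)
  open import Algebra.Properties.Semiring.Sum semiring public
    using (sum; sum-cong-≗; *-distribˡ-sum)
  open import Algebra.Properties.Semiring.Sum semiring
    using (sum-cong-≋; sum-replicate-zero; ∑-distrib-+; ∑-comm; *-distribʳ-sum)
  open import Relation.Binary.Reasoning.Setoid setoid

  private variable n : ℕ

  Vector : ℕ → Set
  Vector n = Fin n → Carrier

  Matrix : ℕ → Set
  Matrix = Mat Carrier

  _≈ᴹ_ : Matrix n → Matrix n → Set ℓ
  X ≈ᴹ Y = ∀ i j → X i j ≈ Y i j

  1ᴹ : Matrix n
  1ᴹ = δ 1# 0#

  diag : Vector n → Matrix n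
  diag d i j = δ (d i) 0# i j

  _*ᴹ_ : Matrix n → Matrix n → Matrix n
  (X *ᴹ Y) i j = sum (λ k → X i k * Y k j)

  _-ᴹ_ : Matrix n → Matrix n → Matrix n
  (X -ᴹ Y) i j = X i j - Y i j

  _ᵛ*_ : Vector n → Matrix n → Vector n
  (v ᵛ* X) j = sum (λ i → v i * X i j)

  trace : Matrix n → Carrier
  trace X = sum (λ i → X i i)

  infixl 7 _*ᴹ_ _ᵛ*_
  infixl 6 _-ᴹ_
  infix 4 _≈ᴹ_

  ∑-neg : (f : Vector n) → sum (λ i → - f i) ≈ - sum f
  ∑-neg {zero}  f = sym -0#≈0#
  ∑-neg {suc n} f = trans (+-congˡ (∑-neg (λ i → f (suc i)))) (-‿+-comm _ _)

  ∑-distrib-- : (f g : Vector n) → sum (λ i → f i - g i) ≈ sum f - sum g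
  ∑-distrib-- f g = trans (∑-distrib-+ f (λ i → - g i)) (+-congˡ (∑-neg g))

  ∑-zero : (f : Vector n) → (∀ i → f i ≈ 0#) → sum f ≈ 0#
  ∑-zero {n} f f≈0 = trans (sum-cong-≋ f≈0) (sum-replicate-zero n)

  ∑-*-assoc : (u : Vector n) (X : Matrix n) (w : Vector n) →
              sum (λ k → sum (λ l → u l * X l k) * w k) ≈ sum (λ l → u l * sum (λ k → X l k * w k))
  ∑-*-assoc u X w = begin
    sum (λ k → sum (λ l → u l * X l k) * w k)
      ≈⟨ sum-cong-≋ (λ k → *-distribʳ-sum (w k) (λ l → u l * X l k)) ⟩
    sum (λ k → sum (λ l → u l * X l k * w k))
      ≈⟨ ∑-comm (λ k l → u l * X l k * w k) ⟩
    sum (λ l → sum (λ k → u l * X l k * w k))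
      ≈⟨ sum-cong-≋ (λ l → sum-cong-≋ (λ k → *-assoc (u l) (X l k) (w k))) ⟩
    sum (λ l → sum (λ k → u l * (X l k * w k)))
      ≈⟨ sum-cong-≋ (λ l → sym (*-distribˡ-sum (u l) (λ k → X l k * w k))) ⟩
    sum (λ l → u l * sum (λ k → X l k * w k)) ∎

  δ-sym : (i j : Fin n) → 1ᴹ i j ≈ 1ᴹ j i
  δ-sym zero    zero    = refl
  δ-sym zero    (suc j) = refl
  δ-sym (suc i) zero    = refl
  δ-sym (suc i) (suc j) = δ-sym i j

  ᵛ*-diag : (v d : Vector n) (j : Fin n) → (v ᵛ* diag d) j ≈ v j * d j
  ᵛ*-diag {suc n} v d zero = begin
    v zero * d zero + sum (λ i → v (suc i) * 0#) ≈⟨ +-congˡ (∑-zero _ (λ i → zeroʳ (v (suc i)))) ⟩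
    v zero * d zero + 0#                          ≈⟨ +-identityʳ _ ⟩
    v zero * d zero                               ∎
  ᵛ*-diag {suc n} v d (suc j) = begin
    v zero * 0# + (tail v ᵛ* diag (tail d)) j
      ≈⟨ +-cong (zeroʳ (v zero)) (ᵛ*-diag (tail v) (tail d) j) ⟩
    0# + v (suc j) * d (suc j)
      ≈⟨ +-identityˡ _ ⟩
    v (suc j) * d (suc j) ∎

  ᵛ*-identityʳ : (v : Vector n) (j : Fin n) → (v ᵛ* 1ᴹ) j ≈ v j
  ᵛ*-identityʳ v j = trans (ᵛ*-diag v (λ _ → 1#) j) (*-identityʳ (v j))

  ᵛ*-congˡ : {u v : Vector n} (X : Matrix n) → (∀ i → u i ≈ v i) →
             ∀ j → (u ᵛ* X) j ≈ (v ᵛ* X) j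
  ᵛ*-congˡ X u≈v j = sum-cong-≋ (λ i → *-congʳ (u≈v i))

  ᵛ*-congʳ : (v : Vector n) {X Y : Matrix n} → X ≈ᴹ Y → ∀ j → (v ᵛ* X) j ≈ (v ᵛ* Y) j
  ᵛ*-congʳ v X≈Y j = sum-cong-≋ (λ i → *-congˡ (X≈Y i j))

  ᵛ*-assoc : (v : Vector n) (X Y : Matrix n) → ∀ j → (v ᵛ* (X *ᴹ Y)) j ≈ (v ᵛ* X ᵛ* Y) j
  ᵛ*-assoc v X Y j = sym (∑-*-assoc v X (λ k → Y k j))

  *ᴹ-identityʳ : (X : Matrix n) → X *ᴹ 1ᴹ ≈ᴹ X
  *ᴹ-identityʳ X i = ᵛ*-identityʳ (X i)

  *ᴹ-identityˡ : (X : Matrix n) → 1ᴹ *ᴹ X ≈ᴹ X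
  *ᴹ-identityˡ X i j = trans
    (sum-cong-≋ (λ k → trans (*-comm (1ᴹ i k) (X k j)) (*-congˡ (δ-sym i k))))
    (ᵛ*-identityʳ (λ k → X k j) i)

  *ᴹ-assoc : (X Y Z : Matrix n) → X *ᴹ Y *ᴹ Z ≈ᴹ X *ᴹ (Y *ᴹ Z)
  *ᴹ-assoc X Y Z i j = ∑-*-assoc (X i) Y (λ k → Z k j)

  *ᴹ-congʳ : (X : Matrix n) {Y Z : Matrix n} → Y ≈ᴹ Z → X *ᴹ Y ≈ᴹ X *ᴹ Z
  *ᴹ-congʳ X Y≈Z i = ᵛ*-congʳ (X i) Y≈Z

  *ᴹ-congˡ : {X Y : Matrix n} (Z : Matrix n) → X ≈ᴹ Y → X *ᴹ Z ≈ᴹ Y *ᴹ Z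
  *ᴹ-congˡ Z X≈Y i = ᵛ*-congˡ Z (X≈Y i)

  *ᴹ-zeroˡ : {X : Matrix n} (Y : Matrix n) → (∀ i j → X i j ≈ 0#) →
             ∀ i j → (X *ᴹ Y) i j ≈ 0#
  *ᴹ-zeroˡ Y X≈0 i j = ∑-zero _ (λ k → trans (*-congʳ (X≈0 i k)) (zeroˡ (Y k j)))

  *ᴹ-distribˡ-ᴹ- : (X Y Z : Matrix n) → X *ᴹ (Y -ᴹ Z) ≈ᴹ X *ᴹ Y -ᴹ X *ᴹ Z
  *ᴹ-distribˡ-ᴹ- X Y Z i j =
    trans (sum-cong-≋ (λ k → x[y-z]≈xy-xz (X i k) (Y k j) (Z k j)))
          (∑-distrib-- (λ k → X i k * Y k j) (λ k → X i k * Z k j))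

  *ᴹ-distribʳ-ᴹ- : (X Y Z : Matrix n) → (X -ᴹ Y) *ᴹ Z ≈ᴹ X *ᴹ Z -ᴹ Y *ᴹ Z
  *ᴹ-distribʳ-ᴹ- X Y Z i j =
    trans (sum-cong-≋ (λ k → [y-z]x≈yx-zx (Z k j) (X i k) (Y i k)))
          (∑-distrib-- (λ k → X i k * Z k j) (λ k → Y i k * Z k j))

  trace-comm : (X Y : Matrix n) → trace (X *ᴹ Y) ≈ trace (Y *ᴹ X)
  trace-comm X Y = trans (∑-comm (λ i k → X i k * Y k i))
                         (sum-cong-≋ (λ k → sum-cong-≋ (λ i → *-comm (X i k) (Y k i))))

  frobenius² : Matrix n → Carrier
  frobenius² X = sum (λ a → sum (λ b → X a b * X a b))

  -- D = 1 - QQᵀ is symmetric and idempotent, so its Frobenius norm is tr D = tr 1 - tr QᵀQ = 0.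
  frobenius²[1-QQᵀ]≈0 : (Q : Matrix n) → transpose Q *ᴹ Q ≈ᴹ 1ᴹ →
                        frobenius² (1ᴹ -ᴹ Q *ᴹ transpose Q) ≈ 0#
  frobenius²[1-QQᵀ]≈0 {n} Q QᵀQ≈1 = begin
    frobenius² D
      ≈⟨ sum-cong-≋ (λ a → sum-cong-≋ (λ b → *-congˡ (D-sym a b))) ⟩
    trace (D *ᴹ D)
      ≈⟨ sum-cong-≋ (λ a → D²≈D a a) ⟩
    trace D
      ≈⟨ ∑-distrib-- (λ a → 1ᴹ a a) (λ a → (Q *ᴹ Qᵀ) a a) ⟩
    trace I - trace (Q *ᴹ Qᵀ)
      ≈⟨ +-congˡ (-‿cong (trans (trace-comm Q Qᵀ) (sum-cong-≋ (λ a → QᵀQ≈1 a a)))) ⟩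
    trace I - trace I
      ≈⟨ -‿inverseʳ _ ⟩
    0# ∎
    where
    I : Matrix n
    I = 1ᴹ
    Qᵀ = transpose Q
    D = I -ᴹ Q *ᴹ Qᵀ

    D-sym : ∀ a b → D a b ≈ D b a
    D-sym a b = +-cong (δ-sym a b) (-‿cong (sum-cong-≋ (λ k → *-comm (Q a k) (Q b k))))

    DQ≈0 : ∀ i j → (D *ᴹ Q) i j ≈ 0#
    DQ≈0 i j = begin
      (D *ᴹ Q) i j                       ≈⟨ *ᴹ-distribʳ-ᴹ- 1ᴹ (Q *ᴹ Qᵀ) Q i j ⟩
      (1ᴹ *ᴹ Q) i j - (Q *ᴹ Qᵀ *ᴹ Q) i j ≈⟨ +-cong (*ᴹ-identityˡ Q i j) (-‿cong QQᵀQ≈Q) ⟩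
      Q i j - Q i j                      ≈⟨ -‿inverseʳ _ ⟩
      0#                                 ∎
      where
      QQᵀQ≈Q : (Q *ᴹ Qᵀ *ᴹ Q) i j ≈ Q i j
      QQᵀQ≈Q = trans (*ᴹ-assoc Q Qᵀ Q i j) (trans (*ᴹ-congʳ Q QᵀQ≈1 i j) (*ᴹ-identityʳ Q i j))

    D²≈D : D *ᴹ D ≈ᴹ D
    D²≈D i j = begin
      (D *ᴹ D) i j                           ≈⟨ *ᴹ-distribˡ-ᴹ- D 1ᴹ (Q *ᴹ Qᵀ) i j ⟩
      (D *ᴹ 1ᴹ) i j - (D *ᴹ (Q *ᴹ Qᵀ)) i j ≈⟨ +-cong (*ᴹ-identityʳ D i j) (-‿cong DQQᵀ≈0) ⟩
      D i j - 0#                             ≈⟨ +-congˡ -0#≈0# ⟩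
      D i j + 0#                             ≈⟨ +-identityʳ _ ⟩
      D i j                                  ∎
      where
      DQQᵀ≈0 : (D *ᴹ (Q *ᴹ Qᵀ)) i j ≈ 0#
      DQQᵀ≈0 = trans (sym (*ᴹ-assoc D Q Qᵀ i j)) (*ᴹ-zeroˡ Qᵀ DQ≈0 i j)

open import Relation.Binary.PropositionalEquality
  using (_≢_; refl; sym; trans; cong; cong₂; subst; module ≡-Reasoning)
open import Data.Product using (∃; _,_; proj₁; proj₂)
open import Data.Sum using (_⊎_; inj₁; inj₂)
open import Data.Empty using (⊥-elim)
open import Relation.Nullary using (¬_; Dec; yes; no)
open import Function using (_∘_)
import Data.Nat.Properties as ℕP
import Data.Nat.Divisibility as ℕD
open ℕD using () renaming (_∣_ to _ℕ∣_)
open import Data.Nat.Coprimality as Cop using ()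
import Data.Fin as Fin
import Data.Fin.Properties as FinP
open FinP using (punchInᵢ≢i; ¬∀⟶∃¬; all?)
open import Data.Vec.Functional using (removeAt; []; _∷_)
import Data.Integer.Properties as ℤP
import Data.Integer.Divisibility as ℤd
open import Data.Integer.Divisibility.Signed
  using (_∣_; divides; ∣m∣n⇒∣m+n; ∣m⇒∣m*n; ∣n⇒∣m*n; ∣⇒∣ᵤ; ∣ᵤ⇒∣; _∣?_)
open import Data.Integer.Tactic.RingSolver using (solve-∀)
import Data.Rational.Properties as ℚP
open ≡-Reasoning

module ℚᴹ = MatrixAlgebra ℚP.+-*-commutativeRing
module ℤᴹ = MatrixAlgebra ℤP.+-*-commutativeRing

sumℤ≡sum : ∀ {n} (f : Fin n → ℤ) → sumℤ f ≡ ℤᴹ.sum f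
sumℤ≡sum {zero}  f = refl
sumℤ≡sum {suc n} f = cong (ℤ._+_ (f zero)) (sumℤ≡sum (λ i → f (suc i)))

sumℚ≡sum : ∀ {n} (f : Fin n → ℚ) → sumℚ f ≡ ℚᴹ.sum f
sumℚ≡sum {zero}  f = refl
sumℚ≡sum {suc n} f = cong (ℚ._+_ (f zero)) (sumℚ≡sum (λ i → f (suc i)))

*ℤ≗*ᴹ : ∀ {n} (X Y : Mat ℤ n) → ∀ i j → (X *ℤ Y) i j ≡ (X ℤᴹ.*ᴹ Y) i j
*ℤ≗*ᴹ X Y i j = sumℤ≡sum (λ k → X i k ℤ.* Y k j)

*ℤ≗*ᴹ² : ∀ {n} (X Y Z : Mat ℤ n) →
         ∀ i j → ((X *ℤ Y) *ℤ Z) i j ≡ (X ℤᴹ.*ᴹ Y ℤᴹ.*ᴹ Z) i j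
*ℤ≗*ᴹ² X Y Z i j = trans (*ℤ≗*ᴹ (X *ℤ Y) Z i j) (ℤᴹ.ᵛ*-congˡ Z (*ℤ≗*ᴹ X Y i) j)

*ℚ≗*ᴹ : ∀ {n} (X Y : Mat ℚ n) → ∀ i j → (X *ℚ Y) i j ≡ (X ℚᴹ.*ᴹ Y) i j
*ℚ≗*ᴹ X Y i j = sumℚ≡sum (λ k → X i k ℚ.* Y k j)

*ℚ≗*ᴹ² : ∀ {n} (X Y Z : Mat ℚ n) →
         ∀ i j → ((X *ℚ Y) *ℚ Z) i j ≡ (X ℚᴹ.*ᴹ Y ℚᴹ.*ᴹ Z) i j
*ℚ≗*ᴹ² X Y Z i j = trans (*ℚ≗*ᴹ (X *ℚ Y) Z i j) (ℚᴹ.ᵛ*-congˡ Z (*ℚ≗*ᴹ X Y i) j)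

ℤtoℚ≡mkℚ : ∀ z → ℤtoℚ z ≡ mkℚ z 0 (Cop.sym (Cop.1-coprimeTo ℤ.∣ z ∣))
ℤtoℚ≡mkℚ z = ℚP.↥p/↧p≡p (mkℚ z 0 _)

ℤtoℚ-+ : ∀ a b → ℤtoℚ (a ℤ.+ b) ≡ ℤtoℚ a ℚ.+ ℤtoℚ b
ℤtoℚ-+ a b rewrite ℤtoℚ≡mkℚ a | ℤtoℚ≡mkℚ b =
  cong (ℚ._/ 1) (cong₂ ℤ._+_ (sym (ℤP.*-identityʳ a)) (sym (ℤP.*-identityʳ b)))

ℤtoℚ-* : ∀ a b → ℤtoℚ (a ℤ.* b) ≡ ℤtoℚ a ℚ.* ℤtoℚ b
ℤtoℚ-* a b rewrite ℤtoℚ≡mkℚ a | ℤtoℚ≡mkℚ b = refl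

ℤtoℚ-injective : ∀ {a b} → ℤtoℚ a ≡ ℤtoℚ b → a ≡ b
ℤtoℚ-injective {a} {b} eq rewrite ℤtoℚ≡mkℚ a | ℤtoℚ≡mkℚ b = cong ℚ.↥_ eq

ℤtoℚ-sum : ∀ {n} (f : Fin n → ℤ) → ℤtoℚ (sumℤ f) ≡ ℚᴹ.sum (λ i → ℤtoℚ (f i))
ℤtoℚ-sum {zero}  f = refl
ℤtoℚ-sum {suc n} f =
  trans (ℤtoℚ-+ (f zero) _) (cong (ℚ._+_ (ℤtoℚ (f zero))) (ℤtoℚ-sum (λ i → f (suc i))))

IsIntegral-sum : ∀ {n} (f : Fin n → ℚ) → (∀ i → IsIntegral (f i)) → IsIntegral (ℚᴹ.sum f)
IsIntegral-sum {zero}  f _ = + 0 , refl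
IsIntegral-sum {suc n} f integral
  with integral zero | IsIntegral-sum (λ i → f (suc i)) (λ i → integral (suc i))
... | a , fa | b , fb = a ℤ.+ b , trans (cong₂ ℚ._+_ fa fb) (sym (ℤtoℚ-+ a b))

IsIntegral-* : ∀ {x y} → IsIntegral x → IsIntegral y → IsIntegral (x ℚ.* y)
IsIntegral-* (a , x≡a) (b , y≡b) = a ℤ.* b , trans (cong₂ ℚ._*_ x≡a y≡b) (sym (ℤtoℚ-* a b))

zero-one-integral : ∀ {x} → x ≡ 0ℚ ⊎ x ≡ 1ℚ → IsIntegral x
zero-one-integral (inj₁ x≡0) = + 0 , x≡0
zero-one-integral (inj₂ x≡1) = + 1 , x≡1

square-nonNeg : ∀ x → 0ℚ ℚ.≤ x ℚ.* x
square-nonNeg x@(mkℚ (+ _)    _ _) = ℚP.nonNegative⁻¹ _ {{ℚP.nonNeg*nonNeg⇒nonNeg x x}}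
square-nonNeg x@(mkℚ -[1+ _ ] _ _) = ℚP.nonNegative⁻¹ _ {{ℚP.nonPos*nonPos⇒nonPos x x}}

square≡0⇒≡0 : ∀ x → x ℚ.* x ≡ 0ℚ → x ≡ 0ℚ
square≡0⇒≡0 x x²≡0 with x ℚP.≟ 0ℚ
... | yes x≡0 = x≡0
... | no  x≢0 = begin
  x                      ≡⟨ sym (ℚP.*-identityʳ x) ⟩
  x ℚ.* 1ℚ               ≡⟨ cong (x ℚ.*_) (sym (ℚP.*-inverseʳ x)) ⟩
  x ℚ.* (x ℚ.* ℚ.1/ x)   ≡⟨ sym (ℚP.*-assoc x x (ℚ.1/ x)) ⟩
  x ℚ.* x ℚ.* ℚ.1/ x     ≡⟨ cong (ℚ._* ℚ.1/ x) x²≡0 ⟩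
  0ℚ ℚ.* ℚ.1/ x          ≡⟨ ℚP.*-zeroˡ (ℚ.1/ x) ⟩
  0ℚ                     ∎
  where instance _ = ℚ.≢-nonZero x≢0

∑-nonNeg : ∀ {n} (f : Fin n → ℚ) → (∀ i → 0ℚ ℚ.≤ f i) → 0ℚ ℚ.≤ ℚᴹ.sum f
∑-nonNeg {zero}  f _   = ℚP.≤-refl
∑-nonNeg {suc n} f f≥0 =
  ℚP.+-mono-≤ (f≥0 zero) (∑-nonNeg (f ∘ suc) (f≥0 ∘ suc))

x+y≡0⇒x≡0 : ∀ {x y} → 0ℚ ℚ.≤ x → 0ℚ ℚ.≤ y → x ℚ.+ y ≡ 0ℚ → x ≡ 0ℚ
x+y≡0⇒x≡0 {x} {y} x≥0 y≥0 x+y≡0 = ℚP.≤-antisym (subst (x ℚ.≤_) x+y≡0 x≤x+y) x≥0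
  where
  x≤x+y : x ℚ.≤ x ℚ.+ y
  x≤x+y = subst (ℚ._≤ x ℚ.+ y) (ℚP.+-identityʳ x) (ℚP.+-monoʳ-≤ x y≥0)

∑-nonNeg≡0 : ∀ {n} (f : Fin n → ℚ) → (∀ i → 0ℚ ℚ.≤ f i) → ℚᴹ.sum f ≡ 0ℚ →
             ∀ i → f i ≡ 0ℚ
∑-nonNeg≡0 {suc n} f f≥0 ∑f≡0 zero    = x+y≡0⇒x≡0 (f≥0 zero) (∑-nonNeg _ (f≥0 ∘ suc)) ∑f≡0
∑-nonNeg≡0 {suc n} f f≥0 ∑f≡0 (suc i) = ∑-nonNeg≡0 (f ∘ suc) (f≥0 ∘ suc) ∑tail≡0 i
  where
  ∑tail≡0 : ℚᴹ.sum (f ∘ suc) ≡ 0ℚ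
  ∑tail≡0 = x+y≡0⇒x≡0 (∑-nonNeg _ (f≥0 ∘ suc)) (f≥0 zero)
                      (trans (ℚP.+-comm _ (f zero)) ∑f≡0)

frobenius²≡0⇒≡0 : ∀ {n} (X : Mat ℚ n) → ℚᴹ.frobenius² X ≡ 0ℚ → ∀ i j → X i j ≡ 0ℚ
frobenius²≡0⇒≡0 X ∑∑≡0 i j = square≡0⇒≡0 (X i j)
  (∑-nonNeg≡0 _ (λ j → square-nonNeg (X i j))
    (∑-nonNeg≡0 _ (λ i → ∑-nonNeg _ (λ j → square-nonNeg (X i j))) ∑∑≡0 i) j)

ℚ*-cancelˡ : ∀ r .{{_ : ℚ.NonZero r}} {x y} → r ℚ.* x ≡ r ℚ.* y → x ≡ y
ℚ*-cancelˡ r {x} {y} rx≡ry = begin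
  x                    ≡⟨ sym (ℚP.*-identityˡ x) ⟩
  1ℚ ℚ.* x             ≡⟨ cong (ℚ._* x) (sym (ℚP.*-inverseˡ r)) ⟩
  ℚ.1/ r ℚ.* r ℚ.* x   ≡⟨ ℚP.*-assoc (ℚ.1/ r) r x ⟩
  ℚ.1/ r ℚ.* (r ℚ.* x) ≡⟨ cong (ℚ.1/ r ℚ.*_) rx≡ry ⟩
  ℚ.1/ r ℚ.* (r ℚ.* y) ≡⟨ sym (ℚP.*-assoc (ℚ.1/ r) r y) ⟩
  ℚ.1/ r ℚ.* r ℚ.* y   ≡⟨ cong (ℚ._* y) (ℚP.*-inverseˡ r) ⟩
  1ℚ ℚ.* y             ≡⟨ ℚP.*-identityˡ y ⟩
  y                    ∎

module _ {n : ℕ} where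
  open ℚᴹ using (1ᴹ; _≈ᴹ_; _*ᴹ_; _ᵛ*_; _-ᴹ_)

  orthogonal⇒QᵀQ≈1 : (Q : Mat ℚ n) → Orthogonal Q → transpose Q *ᴹ Q ≈ᴹ 1ᴹ
  orthogonal⇒QᵀQ≈1 Q QᵀQ≡1 i j =
    trans (sym (*ℚ≗*ᴹ (transpose Q) Q i j)) (cong (λ X → X i j) QᵀQ≡1)

  orthogonal⇒QQᵀ≈1 : (Q : Mat ℚ n) → Orthogonal Q → Q *ᴹ transpose Q ≈ᴹ 1ᴹ
  orthogonal⇒QQᵀ≈1 Q QᵀQ≡1 i j =
    sym (x∙y⁻¹≈ε⇒x≈y _ _ (frobenius²≡0⇒≡0 D ∥D∥²≡0 i j))
    where
    open import Algebra.Properties.Ring ℚP.+-*-ring using (x∙y⁻¹≈ε⇒x≈y)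
    D = 1ᴹ -ᴹ Q *ᴹ transpose Q
    ∥D∥²≡0 = ℚᴹ.frobenius²[1-QQᵀ]≈0 Q (orthogonal⇒QᵀQ≈1 Q QᵀQ≡1)

  ᵛ*-integral : (v : Fin n → ℚ) (X : Mat ℚ n) → (∀ i → IsIntegral (v i)) → IntegralMat X →
                ∀ j → IsIntegral ((v ᵛ* X) j)
  ᵛ*-integral v X v-integral X-integral j =
    IsIntegral-sum _ (λ i → IsIntegral-* (v-integral i) (X-integral i j))

Aℚ : ∀ {n} → Graph n → Mat ℚ n
Aℚ G i j = ℤtoℚ (Graph.A G i j)

walkℚ : ∀ {n} → Graph n → ℕ → Fin n → ℚ
walkℚ G t i = ℤtoℚ (walkVec (Graph.A G) t i)

module _ {n : ℕ} (G : Graph n) where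
  open ℚᴹ

  walkℚ-suc : ∀ t i → walkℚ G (suc t) i ≡ (walkℚ G t ᵛ* Aℚ G) i
  walkℚ-suc t i = begin
    ℤtoℚ (sumℤ (λ j → A i j ℤ.* walkVec A t j))
      ≡⟨ ℤtoℚ-sum (λ j → A i j ℤ.* walkVec A t j) ⟩
    sum (λ j → ℤtoℚ (A i j ℤ.* walkVec A t j))
      ≡⟨ sum-cong-≗ (λ j → ℤtoℚ-* (A i j) (walkVec A t j)) ⟩
    sum (λ j → ℤtoℚ (A i j) ℚ.* walkℚ G t j)
      ≡⟨ sum-cong-≗ (λ j → ℚP.*-comm (ℤtoℚ (A i j)) (walkℚ G t j)) ⟩
    sum (λ j → walkℚ G t j ℚ.* ℤtoℚ (A i j))
      ≡⟨ sum-cong-≗ (λ j → cong (λ a → walkℚ G t j ℚ.* ℤtoℚ a) (Graph.symm G i j)) ⟩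
    (walkℚ G t ᵛ* Aℚ G) i ∎
    where A = Graph.A G

  -- Vectors act on the left, so walkℚ G t ᵛ* Q is eᵀAᵗQ. With QQᵀ = 1 this is eᵀQBᵗ
  -- for B = QᵀAQ, and eᵀQ = eᵀQᵀQ = eᵀ since Qe = e.
  walk-integral : (Q : Mat ℚ n) → InQ G Q → ∀ t j → IsIntegral ((walkℚ G t ᵛ* Q) j)
  walk-integral Q (Q-orthogonal , Q-regular , B-adjacency) = integral
    where
    A = Aℚ G
    Qᵀ = transpose Q
    B = Qᵀ *ᴹ A *ᴹ Q
    QᵀQ≈1 = orthogonal⇒QᵀQ≈1 Q Q-orthogonal
    QQᵀ≈1 = orthogonal⇒QQᵀ≈1 Q Q-orthogonal

    B-integral : IntegralMat B
    B-integral i j =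
      subst IsIntegral (*ℚ≗*ᴹ² Qᵀ A Q i j) (zero-one-integral (proj₁ B-adjacency i j))

    e : Fin n → ℚ
    e _ = 1ℚ

    eQᵀ≡e : ∀ i → (e ᵛ* Qᵀ) i ≡ 1ℚ
    eQᵀ≡e i = trans (sum-cong-≗ (λ k → ℚP.*-identityˡ (Q i k)))
                    (trans (sym (sumℚ≡sum (Q i))) (Q-regular i))

    eQ≡e : ∀ j → (e ᵛ* Q) j ≡ 1ℚ
    eQ≡e j = begin
      (e ᵛ* Q) j          ≡⟨ ᵛ*-congˡ Q (λ i → sym (eQᵀ≡e i)) j ⟩
      (e ᵛ* Qᵀ ᵛ* Q) j    ≡⟨ sym (ᵛ*-assoc e Qᵀ Q j) ⟩
      (e ᵛ* (Qᵀ *ᴹ Q)) j  ≡⟨ ᵛ*-congʳ e QᵀQ≈1 j ⟩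
      (e ᵛ* 1ᴹ) j         ≡⟨ ᵛ*-identityʳ e j ⟩
      1ℚ                  ∎

    AQ≈QB : A *ᴹ Q ≈ᴹ Q *ᴹ B
    AQ≈QB i j = sym (begin
      (Q *ᴹ (Qᵀ *ᴹ A *ᴹ Q)) i j ≡⟨ sym (*ᴹ-assoc Q (Qᵀ *ᴹ A) Q i j) ⟩
      (Q *ᴹ (Qᵀ *ᴹ A) *ᴹ Q) i j ≡⟨ *ᴹ-congˡ Q (λ a b → sym (*ᴹ-assoc Q Qᵀ A a b)) i j ⟩
      (Q *ᴹ Qᵀ *ᴹ A *ᴹ Q) i j   ≡⟨ *ᴹ-congˡ Q (*ᴹ-congˡ A QQᵀ≈1) i j ⟩
      (1ᴹ *ᴹ A *ᴹ Q) i j        ≡⟨ *ᴹ-congˡ Q (*ᴹ-identityˡ A) i j ⟩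
      (A *ᴹ Q) i j              ∎)

    walk-suc : ∀ t j → (walkℚ G (suc t) ᵛ* Q) j ≡ (walkℚ G t ᵛ* Q ᵛ* B) j
    walk-suc t j = begin
      (walkℚ G (suc t) ᵛ* Q) j  ≡⟨ ᵛ*-congˡ Q (walkℚ-suc t) j ⟩
      (walkℚ G t ᵛ* A ᵛ* Q) j   ≡⟨ sym (ᵛ*-assoc (walkℚ G t) A Q j) ⟩
      (walkℚ G t ᵛ* (A *ᴹ Q)) j ≡⟨ ᵛ*-congʳ (walkℚ G t) AQ≈QB j ⟩
      (walkℚ G t ᵛ* (Q *ᴹ B)) j ≡⟨ ᵛ*-assoc (walkℚ G t) Q B j ⟩
      (walkℚ G t ᵛ* Q ᵛ* B) j   ∎

    integral : ∀ t j → IsIntegral ((walkℚ G t ᵛ* Q) j)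
    integral zero    j = + 1 , eQ≡e j
    integral (suc t) j =
      subst IsIntegral (sym (walk-suc t j)) (ᵛ*-integral _ B (integral t) B-integral j)

columns-of-pQ-in-leftKernel : ∀ {n p} (G : Graph n) (Q : Mat ℚ n) (M : Mat ℤ n) → InQ G Q →
  (∀ i j → ℤtoℚ (M i j) ≡ scale p Q i j) → ∀ j k → + p ∣ ((λ i → M i j) ℤᴹ.ᵛ* W G) k
columns-of-pQ-in-leftKernel {n} {p} G Q M Q∈𝒬 M≡pQ j k with walk-integral G Q Q∈𝒬 (toℕ k) j
... | w , wQ≡w = divides w (ℤtoℚ-injective (begin
  ℤtoℚ (ℤᴹ.sum (λ i → Mⱼ i ℤ.* Aᵗe i))
    ≡⟨ cong ℤtoℚ (sym (sumℤ≡sum (λ i → Mⱼ i ℤ.* Aᵗe i))) ⟩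
  ℤtoℚ (sumℤ (λ i → Mⱼ i ℤ.* Aᵗe i))
    ≡⟨ ℤtoℚ-sum (λ i → Mⱼ i ℤ.* Aᵗe i) ⟩
  sum (λ i → ℤtoℚ (Mⱼ i ℤ.* Aᵗe i))
    ≡⟨ sum-cong-≗ (λ i → ℤtoℚ-* (Mⱼ i) (Aᵗe i)) ⟩
  sum (λ i → ℤtoℚ (Mⱼ i) ℚ.* walkℚ G t i)
    ≡⟨ sum-cong-≗ (λ i → cong (ℚ._* walkℚ G t i) (M≡pQ i j)) ⟩
  sum (λ i → pℚ ℚ.* Q i j ℚ.* walkℚ G t i)
    ≡⟨ sum-cong-≗ (λ i → ℚP.*-assoc pℚ (Q i j) (walkℚ G t i)) ⟩
  sum (λ i → pℚ ℚ.* (Q i j ℚ.* walkℚ G t i))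
    ≡⟨ sum-cong-≗ (λ i → cong (pℚ ℚ.*_) (ℚP.*-comm (Q i j) (walkℚ G t i))) ⟩
  sum (λ i → pℚ ℚ.* (walkℚ G t i ℚ.* Q i j))
    ≡⟨ sym (*-distribˡ-sum pℚ (λ i → walkℚ G t i ℚ.* Q i j)) ⟩
  pℚ ℚ.* (walkℚ G t ᵛ* Q) j
    ≡⟨ cong (pℚ ℚ.*_) wQ≡w ⟩
  pℚ ℚ.* ℤtoℚ w
    ≡⟨ sym (ℤtoℚ-* (+ p) w) ⟩
  ℤtoℚ (+ p ℤ.* w)
    ≡⟨ cong ℤtoℚ (ℤP.*-comm (+ p) w) ⟩
  ℤtoℚ (w ℤ.* + p) ∎))
  where
  open ℚᴹ using (sum; sum-cong-≗; *-distribˡ-sum; _ᵛ*_)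
  t = toℕ k
  pℚ = ℤtoℚ (+ p)
  Mⱼ = λ i → M i j
  Aᵗe = walkVec (Graph.A G) t

∣-sum : ∀ {k n} (f : Fin n → ℤ) → (∀ i → k ∣ f i) → k ∣ ℤᴹ.sum f
∣-sum {n = zero}  f _    = divides (+ 0) refl
∣-sum {n = suc n} f k∣f = ∣m∣n⇒∣m+n (k∣f zero) (∣-sum (f ∘ suc) (k∣f ∘ suc))

∣-ᵛ* : ∀ {k n} (v : Fin n → ℤ) (X : Mat ℤ n) → (∀ i → k ∣ v i) →
       ∀ j → k ∣ (v ℤᴹ.ᵛ* X) j
∣-ᵛ* v X k∣v j = ∣-sum _ (λ i → ∣m⇒∣m*n (X i j) (k∣v i))

∣-sum-except : ∀ {k n} (L : Fin n) (f : Fin n → ℤ) → (∀ m → m ≢ L → k ∣ f m) →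
               k ∣ ℤᴹ.sum f ℤ.- f L
∣-sum-except {k} {suc n} L f k∣f =
  subst (k ∣_) (sym ∑f-fL≡rest) (∣-sum _ (λ m → k∣f _ (punchInᵢ≢i L m)))
  where
  open import Algebra.Properties.Ring ℤP.+-*-ring using (xyx⁻¹≈y)
  open import Algebra.Properties.CommutativeMonoid.Sum ℤP.+-0-commutativeMonoid using (sum-remove)
  ∑f-fL≡rest : ℤᴹ.sum f ℤ.- f L ≡ ℤᴹ.sum (removeAt f L)
  ∑f-fL≡rest = trans (cong (ℤ._- f L) (sum-remove f)) (xyx⁻¹≈y (f L) _)

prime-∣-* : ∀ {p} → Prime p → ∀ a b → + p ∣ a ℤ.* b → + p ∣ a ⊎ + p ∣ b
prime-∣-* {p} p-prime a b p∣ab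
  with euclidsLemma ℤ.∣ a ∣ ℤ.∣ b ∣ p-prime (subst (p ℕ∣_) (ℤP.abs-* a b) (∣⇒∣ᵤ p∣ab))
... | inj₁ p∣a = inj₁ (∣ᵤ⇒∣ p∣a)
... | inj₂ p∣b = inj₂ (∣ᵤ⇒∣ p∣b)

prime>1 : ∀ {p} → Prime p → 1 ℕ.< p
prime>1 {p} p-prime = ℕ.nonTrivial⇒n>1 p {{prime⇒nonTrivial p-prime}}

prime∤1 : ∀ {p} → Prime p → ¬ (+ p ∣ + 1)
prime∤1 {p} p-prime p∣1 =
  ℕP.<⇒≱ (prime>1 p-prime) (ℕD.∣⇒≤ (∣⇒∣ᵤ p∣1))

oddPrime∤2 : ∀ {p} → Prime p → Odd p → ¬ (+ p ∣ + 2)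
oddPrime∤2 {p} p-prime p-odd p∣2 = p-odd (subst (2 ℕ∣_) (sym p≡2) ℕD.∣-refl)
  where
  p≡2 : p ≡ 2
  p≡2 = ℕP.≤-antisym (ℕD.∣⇒≤ (∣⇒∣ᵤ p∣2)) (prime>1 p-prime)

snfShape-unit-or-2 : ∀ n p b (m : Fin n) → toℕ m ≢ n ℕ.∸ 1 →
                     snfShape n p b m ≡ + 1 ⊎ snfShape n p b m ≡ + 2
snfShape-unit-or-2 n p b m m≢last with toℕ m ℕ.<? ℕ.⌈ n /2⌉
... | yes _ = inj₁ refl
... | no  _ with toℕ m ℕ.≟ (n ℕ.∸ 1)
...   | yes m≡last = ⊥-elim (m≢last m≡last)
...   | no  _      = inj₂ refl

snfShape-cancel : ∀ {n q} p b → Prime q → Odd q → (L : Fin n) → toℕ L ≡ n ℕ.∸ 1 →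
                  ∀ m → m ≢ L → ∀ y → + q ∣ y ℤ.* snfShape n p b m → + q ∣ y
snfShape-cancel {n} p b q-prime q-odd L L-last m m≢L y q∣yd
  with snfShape-unit-or-2 n p b m (λ m-last → m≢L (FinP.toℕ-injective (trans m-last (sym L-last))))
... | inj₁ d≡1 = subst (_ ∣_) (trans (cong (y ℤ.*_) d≡1) (ℤP.*-identityʳ y)) q∣yd
... | inj₂ d≡2 with prime-∣-* q-prime y (+ 2) (subst (_ ∣_) (cong (y ℤ.*_) d≡2) q∣yd)
...   | inj₁ q∣y = q∣y
...   | inj₂ q∣2 = ⊥-elim (oddPrime∤2 q-prime q-odd q∣2)

-- Writing z = y U, the kernel condition becomes y · diag d ≡ 0 (mod k), which kills
-- every coordinate of y except the L-th.
snf-leftKernel : ∀ {n k} {W : Mat ℤ n} {d : Fin n → ℤ} ((U , _) : HasSNF W d) (L : Fin n) →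
                 (∀ m → m ≢ L → ∀ y → k ∣ y ℤ.* d m → k ∣ y) →
                 (z : Fin n → ℤ) → (∀ j → k ∣ (z ℤᴹ.ᵛ* W) j) →
                 ∃ λ l → ∀ i → k ∣ z i ℤ.- l ℤ.* U L i
snf-leftKernel {n} {k} {W} {d} (U , V , (U⁻¹ , _ , U⁻¹U≡1) , _ , UWV≡D) L d-cancel z zW≡0 =
  y L , λ i → subst (k ∣_) (cong (ℤ._- y L ℤ.* U L i) (yU≡z i))
                    (∣-sum-except L _ (λ m m≢L → ∣m⇒∣m*n (U m i) (k∣y m m≢L)))
  where
  open ℤᴹ
  y = z ᵛ* U⁻¹

  yU≡z : ∀ i → (y ᵛ* U) i ≡ z i
  yU≡z i = begin
    (z ᵛ* U⁻¹ ᵛ* U) i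
      ≡⟨ sym (ᵛ*-assoc z U⁻¹ U i) ⟩
    (z ᵛ* (U⁻¹ *ᴹ U)) i
      ≡⟨ ᵛ*-congʳ z (λ a b → trans (sym (*ℤ≗*ᴹ U⁻¹ U a b)) (cong (λ X → X a b) U⁻¹U≡1)) i ⟩
    (z ᵛ* 1ᴹ) i
      ≡⟨ ᵛ*-identityʳ z i ⟩
    z i ∎

  zWV≡yd : ∀ m → (z ᵛ* W ᵛ* V) m ≡ y m ℤ.* d m
  zWV≡yd m = begin
    (z ᵛ* W ᵛ* V) m
      ≡⟨ ᵛ*-congˡ V (ᵛ*-congˡ W (λ i → sym (yU≡z i))) m ⟩
    (y ᵛ* U ᵛ* W ᵛ* V) m
      ≡⟨ ᵛ*-congˡ V (λ j → sym (ᵛ*-assoc y U W j)) m ⟩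
    (y ᵛ* (U *ᴹ W) ᵛ* V) m
      ≡⟨ sym (ᵛ*-assoc y (U *ᴹ W) V m) ⟩
    (y ᵛ* (U *ᴹ W *ᴹ V)) m
      ≡⟨ ᵛ*-congʳ y (λ a b → trans (sym (*ℤ≗*ᴹ² U W V a b)) (cong (λ X → X a b) UWV≡D)) m ⟩
    (y ᵛ* diag d) m
      ≡⟨ ᵛ*-diag y d m ⟩
    y m ℤ.* d m ∎

  k∣y : ∀ m → m ≢ L → k ∣ y m
  k∣y m m≢L = d-cancel m m≢L (y m) (subst (k ∣_) (zWV≡yd m) (∣-ᵛ* (z ᵛ* W) V zW≡0 m))

rankMod≡1 : ∀ {n p} {M : Mat ℤ n} → Prime p → (r : Fin n → ℤ) →
            (∀ j → ∃ λ l → ∀ i → + p ∣ M i j ℤ.- l ℤ.* r i) →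
            (∃ λ i → ∃ λ j → ¬ (+ p ∣ M i j)) → RankMod p M 1
rankMod≡1 {n} {p} {M} p-prime r proportional (i₀ , j₀ , p∤M) =
  ((λ _ → j₀) , independent) , dependent
  where
  independent : ColsIndepMod p M (λ _ → j₀)
  independent c p∣cM zero
    with prime-∣-* p-prime (c zero) (M i₀ j₀)
                   (subst (+ p ∣_) (ℤP.+-identityʳ _) (∣ᵤ⇒∣ (p∣cM i₀)))
  ... | inj₁ p∣c = ∣⇒∣ᵤ p∣c
  ... | inj₂ p∣M = ⊥-elim (p∤M p∣M)

  -- With columns g₀ ≡ l₀ r and g₁ ≡ l₁ r, the combination l₁ g₀ - l₀ g₁ vanishes, so
  -- independence forces p ∣ l₁; then g₁ ≡ 0 and the combination 0 g₀ + 1 g₁ vanishes too.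
  dependent : (g : Fin 2 → Fin n) → ¬ ColsIndepMod p M g
  dependent g indep = prime∤1 p-prime (∣ᵤ⇒∣ (indep (+ 0 ∷ + 1 ∷ []) second-column (suc zero)))
    where
    cross-multiplication : ∀ l₀ l₁ a b x →
      l₁ ℤ.* (a ℤ.- l₀ ℤ.* x) ℤ.+ ℤ.- l₀ ℤ.* (b ℤ.- l₁ ℤ.* x) ≡
      l₁ ℤ.* a ℤ.+ (ℤ.- l₀ ℤ.* b ℤ.+ + 0)
    cross-multiplication = solve-∀

    select-second : ∀ l₁ a b x →
      b ℤ.- l₁ ℤ.* x ℤ.+ l₁ ℤ.* x ≡ + 0 ℤ.* a ℤ.+ (+ 1 ℤ.* b ℤ.+ + 0)
    select-second = solve-∀

    l₀ = proj₁ (proportional (g zero))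
    l₁ = proj₁ (proportional (g (suc zero)))
    M₀≡l₀r = proj₂ (proportional (g zero))
    M₁≡l₁r = proj₂ (proportional (g (suc zero)))

    cancelling : ∀ i → + p ℤd.∣ sumℤ (λ j → (l₁ ∷ ℤ.- l₀ ∷ []) j ℤ.* M i (g j))
    cancelling i = ∣⇒∣ᵤ (subst (+ p ∣_) (cross-multiplication l₀ l₁ (M i (g zero)) (M i (g (suc zero))) (r i))
      (∣m∣n⇒∣m+n (∣n⇒∣m*n l₁ (M₀≡l₀r i)) (∣n⇒∣m*n (ℤ.- l₀) (M₁≡l₁r i))))

    p∣l₁ : + p ∣ l₁
    p∣l₁ = ∣ᵤ⇒∣ (indep (l₁ ∷ ℤ.- l₀ ∷ []) cancelling zero)

    second-column : ∀ i → + p ℤd.∣ sumℤ (λ j → (+ 0 ∷ + 1 ∷ []) j ℤ.* M i (g j))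
    second-column i = ∣⇒∣ᵤ (subst (+ p ∣_) (select-second l₁ (M i (g zero)) (M i (g (suc zero))) (r i))
      (∣m∣n⇒∣m+n (M₁≡l₁r i) (∣m⇒∣m*n (r i) p∣l₁)))

¬∀⟶∃¬₂ : ∀ {n p} (P : Fin n → Fin n → Set p) → (∀ i j → Dec (P i j)) →
         ¬ (∀ i j → P i j) → ∃ λ i → ∃ λ j → ¬ P i j
¬∀⟶∃¬₂ {n} P P? ¬∀∀P
  with ¬∀⟶∃¬ n (λ i → ∀ j → P i j) (λ i → all? (P? i)) ¬∀∀P
... | i , ¬∀Pi with ¬∀⟶∃¬ n (P i) (P? i) ¬∀Pi
...   | j , ¬Pij = i , j , ¬Pij

module _ {n p} {Q : Mat ℚ n} {M : Mat ℤ n} (p-prime : Prime p)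
         (M≡pQ : ∀ i j → ℤtoℚ (M i j) ≡ scale p Q i j) where

  instance
    p≢0 : ℚ.NonZero (ℤtoℚ (+ p))
    p≢0 = ℚ.≢-nonZero λ p≡0 →
      ℕ.≢-nonZero⁻¹ p {{prime⇒nonZero p-prime}} (ℤP.+-injective (ℤtoℚ-injective p≡0))

  p∣M⇒Q-integral : ∀ {i j} → + p ∣ M i j → IsIntegral (Q i j)
  p∣M⇒Q-integral {i} {j} (divides q M≡qp) = q , ℚ*-cancelˡ (ℤtoℚ (+ p)) (begin
    ℤtoℚ (+ p) ℚ.* Q i j   ≡⟨ sym (M≡pQ i j) ⟩
    ℤtoℚ (M i j)           ≡⟨ cong ℤtoℚ (trans M≡qp (ℤP.*-comm q (+ p))) ⟩
    ℤtoℚ (+ p ℤ.* q)       ≡⟨ ℤtoℚ-* (+ p) q ⟩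
    ℤtoℚ (+ p) ℚ.* ℤtoℚ q  ∎)

  level⇒entry-not-divisible : Level Q p → ∃ λ i → ∃ λ j → ¬ (+ p ∣ M i j)
  level⇒entry-not-divisible (_ , _ , minimal) =
    ¬∀⟶∃¬₂ (λ i j → + p ∣ M i j) (λ i j → + p ∣? M i j) λ p∣M →
      minimal 1 (ℕ.s≤s ℕ.z≤n) (prime>1 p-prime)
        (λ i j → subst IsIntegral (sym (ℚP.*-identityˡ (Q i j))) (p∣M⇒Q-integral (p∣M i j)))

inhabited⇒last : ∀ {n} → Fin n → ∃ λ (L : Fin n) → toℕ L ≡ n ℕ.∸ 1
inhabited⇒last {suc n} _ = Fin.fromℕ n , FinP.toℕ-fromℕ n

lemma2p6 : (n p : ℕ) → Prime p → Odd p →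
    (G : Graph n) → InFp p G →
    (Q : Mat ℚ n) → InQ G Q → Level Q p →
    (M : Mat ℤ n) → (∀ i j → ℤtoℚ (M i j) ≡ scale p Q i j) →
    RankMod p M 1
lemma2p6 n p p-prime p-odd G ((p′ , b , _ , _ , _ , _ , _ , snf) , _) Q Q∈𝒬 ℓ[Q]≡p M M≡pQ =
  let nonzero-entry = level⇒entry-not-divisible {Q = Q} {M = M} p-prime M≡pQ ℓ[Q]≡p
      (L , L-last)  = inhabited⇒last (proj₁ nonzero-entry)
      column-proportional j = snf-leftKernel snf L (snfShape-cancel p′ b p-prime p-odd L L-last)
                                (λ i → M i j) (columns-of-pQ-in-leftKernel G Q M Q∈𝒬 M≡pQ j)
  in rankMod≡1 {M = M} p-prime (proj₁ snf L) column-proportional nonzero-entry
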